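{- Let $\mathbf A\in\mathcal S$. Then $\mathbf A$ satisfies: (a) $x\to(y\to z)\approx y\to(x\to z)$; (b) $x'\to y\approx y'\to x$; (c) $x\to y\approx y'\to x'$; (d) $x\to y'\approx y\to x'$.
   Context: A zroupoid is an algebra $\langle A,\to,0\rangle$ with $\to$ binary and $0$ a constant; write $x' := x\to 0$. An implication zroupoid ($\mathcal I$-zroupoid) is a zroupoid satisfying (I) $(x\to y)\to z \approx ((z'\to x)\to(y\to z)')'$ and (I$_0$) $0''\approx 0$. $\mathcal S$ is the variety of $\mathcal I$-zroupoids satisfying $x''\approx x$ and $(x\to y')'\approx (y\to x')'$. -}

module Defs where

open import Level using (Level; suc; _⊔_)
open import Relation.Binary.PropositionalEquality using (_≡_)
open import Data.Product using (_×_)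

record Zroupoid (a : Level) : Set (suc a) where
  infixr 5 _⇒_
  field
    Carrier : Set a
    _⇒_     : Carrier → Carrier → Carrier
    𝟘       : Carrier

  _′ : Carrier → Carrier
  x ′ = x ⇒ 𝟘

module _ {a : Level} (A : Zroupoid a) where
  open Zroupoid A

  SatisfiesI : Set a
  SatisfiesI = ∀ x y z → (x ⇒ y) ⇒ z ≡ ((((z ′) ⇒ x) ⇒ ((y ⇒ z) ′)) ′)

  SatisfiesI₀ : Set a
  SatisfiesI₀ = (𝟘 ′) ′ ≡ 𝟘

  IsIZroupoid : Set a
  IsIZroupoid = SatisfiesI × SatisfiesI₀

  InS : Set a
  InS = IsIZroupoid
      × (∀ x → (x ′) ′ ≡ x)
      × (∀ x y → (x ⇒ (y ′)) ′ ≡ (y ⇒ (x ′)) ′)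

module Submission where

-- In an algebra of 𝒮 put  x · y := (x → y')'  and  x + y := x' → y.
-- Then 0 and 1 := 0' are units for + and ·, both operations are commutative,
-- identity (I) says exactly that + distributes over ·, and since ' is an
-- involution exchanging + and ·, also · distributes over +.  Identities (b),
-- (c), (d) are the contraposition laws that come directly from the axioms of
-- 𝒮, while (a) is the law  x · (y · z) ≈ y · (x · z)  rewritten via
-- x → y = (x · y')'.
--
-- The bulk of the file shows that this law holds in every *distributive
-- bimonoid*: a structure with two commutative operations with units, each
-- distributing over the other.  No complement laws are assumed, so
-- absorption only holds "up to a zero":  x · (x + y) ≈ x + y · 0.
-- Module Absorption derives such weakened absorption laws up to
-- x · (x · y) ≈ x · y; by self-duality of the axioms its dual
-- x + (x + y) ≈ x + y comes for free.  Module Exchange then proves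
-- y · (x · z) ≈ (x · z) · (y · z), whose right side is symmetric in x and y,
-- which gives the exchange law.

open import Defs
open import Level using (Level) renaming (suc to lsuc)
open import Relation.Binary.PropositionalEquality
  using (_≡_; sym; trans; cong; cong₂; module ≡-Reasoning)
open import Data.Product using (_×_; _,_; proj₁; proj₂)

record DistributiveBimonoid (a : Level) : Set (lsuc a) where
  infixl 6 _+_
  infixl 7 _·_
  field
    Carrier     : Set a
    _+_ _·_     : Carrier → Carrier → Carrier
    0# 1#       : Carrier
    +-comm      : ∀ x y → x + y ≡ y + x
    ·-comm      : ∀ x y → x · y ≡ y · x
    +-identityʳ : ∀ x → x + 0# ≡ x
    ·-identityʳ : ∀ x → x · 1# ≡ x
    +-distrib-· : ∀ x y z → x + y · z ≡ (x + y) · (x + z)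
    ·-distrib-+ : ∀ x y z → x · (y + z) ≡ x · y + x · z

dual : ∀ {a} → DistributiveBimonoid a → DistributiveBimonoid a
dual B = record
  { Carrier     = Carrier
  ; _+_         = _·_
  ; _·_         = _+_
  ; 0#          = 1#
  ; 1#          = 0#
  ; +-comm      = ·-comm
  ; ·-comm      = +-comm
  ; +-identityʳ = ·-identityʳ
  ; ·-identityʳ = +-identityʳ
  ; +-distrib-· = ·-distrib-+
  ; ·-distrib-+ = +-distrib-·
  }
  where open DistributiveBimonoid B

module Absorption {a} (B : DistributiveBimonoid a) where
  open DistributiveBimonoid B
  open ≡-Reasoning

  ·-absorbs-+ : ∀ x y → x · (x + y) ≡ x + y · 0#
  ·-absorbs-+ x y = begin
    x · (x + y)          ≡⟨ cong (_· (x + y)) (sym (+-identityʳ x)) ⟩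
    (x + 0#) · (x + y)   ≡⟨ sym (+-distrib-· x 0# y) ⟩
    x + 0# · y           ≡⟨ cong (x +_) (·-comm 0# y) ⟩
    x + y · 0#           ∎

  +-absorbs-·-via-1 : ∀ x y → x + x · y ≡ x · (y + 1#)
  +-absorbs-·-via-1 x y = begin
    x + x · y            ≡⟨ cong (_+ x · y) (sym (·-identityʳ x)) ⟩
    x · 1# + x · y       ≡⟨ sym (·-distrib-+ x 1# y) ⟩
    x · (1# + y)         ≡⟨ cong (x ·_) (+-comm 1# y) ⟩
    x · (y + 1#)         ∎

  1+1≡1 : 1# + 1# ≡ 1#
  1+1≡1 = begin
    1# + 1#              ≡⟨ sym (trans (·-comm 1# (1# + 1#)) (·-identityʳ (1# + 1#))) ⟩
    1# · (1# + 1#)       ≡⟨ ·-absorbs-+ 1# 1# ⟩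
    1# + 1# · 0#         ≡⟨ cong (1# +_) (trans (·-comm 1# 0#) (·-identityʳ 0#)) ⟩
    1# + 0#              ≡⟨ +-identityʳ 1# ⟩
    1#                   ∎

  +-idem : ∀ x → x + x ≡ x
  +-idem x = begin
    x + x                ≡⟨ cong (x +_) (sym (·-identityʳ x)) ⟩
    x + x · 1#           ≡⟨ +-absorbs-·-via-1 x 1# ⟩
    x · (1# + 1#)        ≡⟨ cong (x ·_) 1+1≡1 ⟩
    x · 1#               ≡⟨ ·-identityʳ x ⟩
    x                    ∎

  +-absorbs-· : ∀ x y → x + x · y ≡ x + y · 0#
  +-absorbs-· x y = begin
    x + x · y            ≡⟨ +-distrib-· x x y ⟩
    (x + x) · (x + y)    ≡⟨ cong (_· (x + y)) (+-idem x) ⟩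
    x · (x + y)          ≡⟨ ·-absorbs-+ x y ⟩
    x + y · 0#           ∎

  ·-absorbs-+-via-1 : ∀ x y → x · (y + 1#) ≡ x + y · 0#
  ·-absorbs-+-via-1 x y = trans (sym (+-absorbs-·-via-1 x y)) (+-absorbs-· x y)

  +-absorbs-zero-multiple : ∀ x y → x · y + x · 0# ≡ x · y
  +-absorbs-zero-multiple x y =
    trans (sym (·-distrib-+ x y 0#)) (cong (x ·_) (+-identityʳ y))

  ·-absorbs-+-multiple : ∀ x y → x · (y + x · y) ≡ x · y
  ·-absorbs-+-multiple x y = begin
    x · (y + x · y)        ≡⟨ ·-distrib-+ x y (x · y) ⟩
    x · y + x · (x · y)    ≡⟨ cong (x · y +_) (·-comm x (x · y)) ⟩
    x · y + (x · y) · x    ≡⟨ +-absorbs-· (x · y) x ⟩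
    x · y + x · 0#         ≡⟨ +-absorbs-zero-multiple x y ⟩
    x · y                  ∎

  ·-absorbs-+-zero : ∀ x y → x · (y + x · 0#) ≡ x · y
  ·-absorbs-+-zero x y = begin
    x · (y + x · 0#)     ≡⟨ cong (x ·_) (sym (+-absorbs-· y x)) ⟩
    x · (y + y · x)      ≡⟨ cong (λ t → x · (y + t)) (·-comm y x) ⟩
    x · (y + x · y)      ≡⟨ ·-absorbs-+-multiple x y ⟩
    x · y                ∎

  +-zero-of-multiple : ∀ x y → x + (x · y) · 0# ≡ x + y · 0#
  +-zero-of-multiple x y = begin
    x + (x · y) · 0#              ≡⟨ sym (·-absorbs-+-via-1 x (x · y)) ⟩
    x · (x · y + 1#)              ≡⟨ cong (x ·_) (+-comm (x · y) 1#) ⟩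
    x · (1# + x · y)              ≡⟨ cong (x ·_) (+-distrib-· 1# x y) ⟩
    x · ((1# + x) · (1# + y))     ≡⟨ cong (x ·_) (·-comm (1# + x) (1# + y)) ⟩
    x · ((1# + y) · (1# + x))     ≡⟨ cong (λ t → x · ((1# + y) · t)) (+-comm 1# x) ⟩
    x · ((1# + y) · (x + 1#))     ≡⟨ cong (x ·_) (·-absorbs-+-via-1 (1# + y) x) ⟩
    x · ((1# + y) + x · 0#)       ≡⟨ ·-absorbs-+-zero x (1# + y) ⟩
    x · (1# + y)                  ≡⟨ cong (x ·_) (+-comm 1# y) ⟩
    x · (y + 1#)                  ≡⟨ ·-absorbs-+-via-1 x y ⟩
    x + y · 0#                    ∎

  ·-absorbs-multiple : ∀ x y → x · (x · y) ≡ x · y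
  ·-absorbs-multiple x y = begin
    x · (x · y)                   ≡⟨ ·-comm x (x · y) ⟩
    (x · y) · x                   ≡⟨ sym (·-absorbs-+-zero (x · y) x) ⟩
    (x · y) · (x + (x · y) · 0#)  ≡⟨ cong ((x · y) ·_) (+-zero-of-multiple x y) ⟩
    (x · y) · (x + y · 0#)        ≡⟨ cong ((x · y) ·_) (sym (+-absorbs-· x y)) ⟩
    (x · y) · (x + x · y)         ≡⟨ cong ((x · y) ·_) (+-comm x (x · y)) ⟩
    (x · y) · (x · y + x)         ≡⟨ ·-absorbs-+ (x · y) x ⟩
    x · y + x · 0#                ≡⟨ +-absorbs-zero-multiple x y ⟩
    x · y                         ∎

module Exchange {a} (B : DistributiveBimonoid a) where
  open DistributiveBimonoid B
  open Absorption B
  open Absorption (dual B) using () renaming (·-absorbs-multiple to +-absorbs-sum)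
  open ≡-Reasoning

  ·-absorbs-+-factor : ∀ x y z → x · (y + x · z) ≡ x · (y + z)
  ·-absorbs-+-factor x y z = begin
    x · (y + x · z)            ≡⟨ ·-distrib-+ x y (x · z) ⟩
    x · y + x · (x · z)        ≡⟨ cong (x · y +_) (·-absorbs-multiple x z) ⟩
    x · y + x · z              ≡⟨ sym (·-distrib-+ x y z) ⟩
    x · (y + z)                ∎

  multiple-·-sum : ∀ x y z → (x · y) · (x + z) ≡ x · y + z · 0#
  multiple-·-sum x y z = begin
    (x · y) · (x + z)            ≡⟨ ·-distrib-+ (x · y) x z ⟩
    (x · y) · x + (x · y) · z    ≡⟨ cong (_+ (x · y) · z) (trans (·-comm (x · y) x) (·-absorbs-multiple x y)) ⟩
    x · y + (x · y) · z          ≡⟨ +-absorbs-· (x · y) z ⟩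
    x · y + z · 0#               ∎

  1+zero : ∀ x → 1# + x · 0# ≡ x + 1#
  1+zero x = begin
    1# + x · 0#          ≡⟨ sym (·-absorbs-+ 1# x) ⟩
    1# · (1# + x)        ≡⟨ trans (·-comm 1# (1# + x)) (·-identityʳ (1# + x)) ⟩
    1# + x               ≡⟨ +-comm 1# x ⟩
    x + 1#               ∎

  +-absorbs-·-zero : ∀ x y → x + x · (y · 0#) ≡ x + y · 0#
  +-absorbs-·-zero x y = begin
    x + x · (y · 0#)     ≡⟨ +-absorbs-·-via-1 x (y · 0#) ⟩
    x · (y · 0# + 1#)    ≡⟨ cong (x ·_) (trans (+-comm (y · 0#) 1#) (1+zero y)) ⟩
    x · (y + 1#)         ≡⟨ ·-absorbs-+-via-1 x y ⟩
    x + y · 0#           ∎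

  zero-of-sum : ∀ x y → 0# · (x + y) ≡ x · (y · 0#)
  zero-of-sum x y = begin
    0# · (x + y)                 ≡⟨ ·-distrib-+ 0# x y ⟩
    0# · x + 0# · y              ≡⟨ cong₂ _+_ (·-comm 0# x) (·-comm 0# y) ⟩
    x · 0# + y · 0#              ≡⟨ +-comm (x · 0#) (y · 0#) ⟩
    y · 0# + x · 0#              ≡⟨ sym (·-absorbs-+ (y · 0#) x) ⟩
    (y · 0#) · (y · 0# + x)      ≡⟨ cong ((y · 0#) ·_) (+-comm (y · 0#) x) ⟩
    (y · 0#) · (x + y · 0#)      ≡⟨ cong ((y · 0#) ·_) (sym (+-absorbs-·-zero x y)) ⟩
    (y · 0#) · (x + x · (y · 0#)) ≡⟨ cong (λ t → (y · 0#) · (x + t)) (·-comm x (y · 0#)) ⟩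
    (y · 0#) · (x + (y · 0#) · x) ≡⟨ ·-absorbs-+-multiple (y · 0#) x ⟩
    (y · 0#) · x                 ≡⟨ ·-comm (y · 0#) x ⟩
    x · (y · 0#)                 ∎

  ·-raise : ∀ x y z → x · (y + z · 0#) ≡ x · y + z · 0#
  ·-raise x y z = begin
    x · (y + z · 0#)             ≡⟨ ·-distrib-+ x y (z · 0#) ⟩
    x · y + x · (z · 0#)         ≡⟨ cong (x · y +_) (sym (zero-of-sum x z)) ⟩
    x · y + 0# · (x + z)         ≡⟨ cong (x · y +_) (·-comm 0# (x + z)) ⟩
    x · y + (x + z) · 0#         ≡⟨ sym (multiple-·-sum x y (x + z)) ⟩
    (x · y) · (x + (x + z))      ≡⟨ cong ((x · y) ·_) (+-absorbs-sum x z) ⟩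
    (x · y) · (x + z)            ≡⟨ multiple-·-sum x y z ⟩
    x · y + z · 0#               ∎

  ·-·-absorbs-zero : ∀ x y z → x · (y · z) + z · 0# ≡ x · (y · z)
  ·-·-absorbs-zero x y z = begin
    x · (y · z) + z · 0#         ≡⟨ sym (·-raise x (y · z) z) ⟩
    x · (y · z + z · 0#)         ≡⟨ cong (λ t → x · (t + z · 0#)) (·-comm y z) ⟩
    x · (z · y + z · 0#)         ≡⟨ cong (x ·_) (+-absorbs-zero-multiple z y) ⟩
    x · (z · y)                  ≡⟨ cong (x ·_) (·-comm z y) ⟩
    x · (y · z)                  ∎

  ·-raise-multiple : ∀ x y z → x · (y + y · z) ≡ x · y + z · 0#
  ·-raise-multiple x y z = trans (cong (x ·_) (+-absorbs-· y z)) (·-raise x y z)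

  ·-·-sum : ∀ x y z → x · (y · (x + z)) ≡ x · y + z · 0#
  ·-·-sum x y z = begin
    x · (y · (x + z))            ≡⟨ cong (x ·_) (·-distrib-+ y x z) ⟩
    x · (y · x + y · z)          ≡⟨ cong (x ·_) (+-comm (y · x) (y · z)) ⟩
    x · (y · z + y · x)          ≡⟨ cong (λ t → x · (y · z + t)) (·-comm y x) ⟩
    x · (y · z + x · y)          ≡⟨ ·-absorbs-+-factor x (y · z) y ⟩
    x · (y · z + y)              ≡⟨ cong (x ·_) (+-comm (y · z) y) ⟩
    x · (y + y · z)              ≡⟨ ·-raise-multiple x y z ⟩
    x · y + z · 0#               ∎

  -- The key identity: its right-hand side is symmetric in x and y up to ·-comm.
  ·-via-common-factor : ∀ x y z → y · (x · z) ≡ (x · z) · (y · z)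
  ·-via-common-factor x y z = begin
    y · (x · z)                  ≡⟨ sym (·-·-absorbs-zero y x z) ⟩
    y · (x · z) + z · 0#         ≡⟨ cong (_+ z · 0#) (·-comm y (x · z)) ⟩
    (x · z) · y + z · 0#         ≡⟨ sym (·-·-sum (x · z) y z) ⟩
    (x · z) · (y · (x · z + z))  ≡⟨ cong (λ t → (x · z) · (y · t)) (+-comm (x · z) z) ⟩
    (x · z) · (y · (z + x · z))  ≡⟨ cong (λ t → (x · z) · (y · (z + t))) (·-comm x z) ⟩
    (x · z) · (y · (z + z · x))  ≡⟨ cong ((x · z) ·_) (·-raise-multiple y z x) ⟩
    (x · z) · (y · z + x · 0#)   ≡⟨ ·-raise (x · z) (y · z) x ⟩
    (x · z) · (y · z) + x · 0#   ≡⟨ cong (_+ x · 0#) (·-comm (x · z) (y · z)) ⟩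
    (y · z) · (x · z) + x · 0#   ≡⟨ cong (λ t → (y · z) · t + x · 0#) (·-comm x z) ⟩
    (y · z) · (z · x) + x · 0#   ≡⟨ ·-·-absorbs-zero (y · z) z x ⟩
    (y · z) · (z · x)            ≡⟨ cong ((y · z) ·_) (·-comm z x) ⟩
    (y · z) · (x · z)            ≡⟨ ·-comm (y · z) (x · z) ⟩
    (x · z) · (y · z)            ∎

  -- Left commutativity of ·; together with ·-comm this is associativity.
  ·-exchange : ∀ x y z → x · (y · z) ≡ y · (x · z)
  ·-exchange x y z = begin
    x · (y · z)                  ≡⟨ ·-via-common-factor y x z ⟩
    (y · z) · (x · z)            ≡⟨ ·-comm (y · z) (x · z) ⟩
    (x · z) · (y · z)            ≡⟨ sym (·-via-common-factor x y z) ⟩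
    y · (x · z)                  ∎

module InS-Properties {a} (A : Zroupoid a) (S : InS A) where
  open Zroupoid A
  open ≡-Reasoning

  -- The axioms of 𝒮 that are used; (I₀) follows from involutivity.
  identity-I : SatisfiesI A
  identity-I = proj₁ (proj₁ S)

  ′-involutive : ∀ x → x ′ ′ ≡ x
  ′-involutive = proj₁ (proj₂ S)

  ′-injective : ∀ {x y} → x ′ ≡ y ′ → x ≡ y
  ′-injective {x} {y} eq = trans (sym (′-involutive x)) (trans (cong _′ eq) (′-involutive y))

  contraposition-′ : ∀ x y → x ⇒ y ′ ≡ y ⇒ x ′
  contraposition-′ x y = ′-injective (proj₂ (proj₂ S) x y)

  contraposition : ∀ x y → x ⇒ y ≡ y ′ ⇒ x ′
  contraposition x y = trans (cong (x ⇒_) (sym (′-involutive y))) (contraposition-′ x (y ′))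

  ′-contraposition : ∀ x y → x ′ ⇒ y ≡ y ′ ⇒ x
  ′-contraposition x y = trans (contraposition (x ′) y) (cong (y ′ ⇒_) (′-involutive x))

  -- The two operations of the bimonoid; x → y is recovered as (x · y')'.
  infixl 6 _+_
  infixl 7 _·_

  _·_ : Carrier → Carrier → Carrier
  x · y = (x ⇒ y ′) ′

  _+_ : Carrier → Carrier → Carrier
  x + y = x ′ ⇒ y

  ′-of-· : ∀ x y → (x · y) ′ ≡ x ′ + y ′
  ′-of-· x y = trans (′-involutive (x ⇒ y ′)) (cong (_⇒ y ′) (sym (′-involutive x)))

  ′-of-+ : ∀ x y → (x + y) ′ ≡ x ′ · y ′
  ′-of-+ x y = cong (λ t → (x ′ ⇒ t) ′) (sym (′-involutive y))

  -- Identity (I) is exactly the distributivity of + over ·.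
  +-distrib-· : ∀ x y z → x + y · z ≡ (x + y) · (x + z)
  +-distrib-· x y z = begin
    x ′ ⇒ (y ⇒ z ′) ′                    ≡⟨ ′-contraposition x ((y ⇒ z ′) ′) ⟩
    (y ⇒ z ′) ′ ′ ⇒ x                    ≡⟨ cong (_⇒ x) (′-involutive (y ⇒ z ′)) ⟩
    (y ⇒ z ′) ⇒ x                        ≡⟨ identity-I y (z ′) x ⟩
    ((x ′ ⇒ y) ⇒ (z ′ ⇒ x) ′) ′          ≡⟨ cong (λ t → ((x ′ ⇒ y) ⇒ t ′) ′) (′-contraposition z x) ⟩
    ((x ′ ⇒ y) ⇒ (x ′ ⇒ z) ′) ′          ∎

  ·-distrib-+ : ∀ x y z → x · (y + z) ≡ x · y + x · z
  ·-distrib-+ x y z = ′-injective (begin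
    (x · (y + z)) ′                  ≡⟨ ′-of-· x (y + z) ⟩
    x ′ + (y + z) ′                  ≡⟨ cong (x ′ +_) (′-of-+ y z) ⟩
    x ′ + y ′ · z ′                  ≡⟨ +-distrib-· (x ′) (y ′) (z ′) ⟩
    (x ′ + y ′) · (x ′ + z ′)        ≡⟨ sym (cong₂ _·_ (′-of-· x y) (′-of-· x z)) ⟩
    (x · y) ′ · (x · z) ′            ≡⟨ sym (′-of-+ (x · y) (x · z)) ⟩
    (x · y + x · z) ′                ∎)

  bimonoid : DistributiveBimonoid a
  bimonoid = record
    { Carrier     = Carrier
    ; _+_         = _+_
    ; _·_         = _·_
    ; 0#          = 𝟘
    ; 1#          = 𝟘 ′
    ; +-comm      = ′-contraposition
    ; ·-comm      = proj₂ (proj₂ S)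
    ; +-identityʳ = ′-involutive
    ; ·-identityʳ = λ x → trans (cong (λ t → (x ⇒ t) ′) (′-involutive 𝟘)) (′-involutive x)
    ; +-distrib-· = +-distrib-·
    ; ·-distrib-+ = ·-distrib-+
    }

  ⇒-⇒-as-· : ∀ x y z → x ⇒ (y ⇒ z) ≡ (x · (y · z ′)) ′
  ⇒-⇒-as-· x y z = begin
    x ⇒ (y ⇒ z)                  ≡⟨ cong (λ t → x ⇒ (y ⇒ t)) (sym (′-involutive z)) ⟩
    x ⇒ (y ⇒ z ′ ′)              ≡⟨ cong (x ⇒_) (sym (′-involutive (y ⇒ z ′ ′))) ⟩
    x ⇒ (y · z ′) ′              ≡⟨ sym (′-involutive (x ⇒ (y · z ′) ′)) ⟩
    (x · (y · z ′)) ′            ∎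

  ⇒-exchange : ∀ x y z → x ⇒ (y ⇒ z) ≡ y ⇒ (x ⇒ z)
  ⇒-exchange x y z = begin
    x ⇒ (y ⇒ z)                  ≡⟨ ⇒-⇒-as-· x y z ⟩
    (x · (y · z ′)) ′            ≡⟨ cong _′ (Exchange.·-exchange bimonoid x y (z ′)) ⟩
    (y · (x · z ′)) ′            ≡⟨ sym (⇒-⇒-as-· y x z) ⟩
    y ⇒ (x ⇒ z)                  ∎

lemma3p1 : ∀ {a : Level} (A : Zroupoid a) → InS A →
    let open Zroupoid A in
      (∀ x y z → x ⇒ (y ⇒ z) ≡ y ⇒ (x ⇒ z))
    × (∀ x y → (x ′) ⇒ y ≡ (y ′) ⇒ x)
    × (∀ x y → x ⇒ y ≡ (y ′) ⇒ (x ′))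
    × (∀ x y → x ⇒ (y ′) ≡ y ⇒ (x ′))
lemma3p1 A S = ⇒-exchange , ′-contraposition , contraposition , contraposition-′
  where open InS-Properties A S
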